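{- Let $G$ be a connected finite simple graph with $n$ vertices and maximum degree $\Delta(G)$, and fix an integer $r$ with $7\leq r\leq \Delta(G)+1$. Suppose $G$ is $(n-r+1)$-connected and $G$ does not contain the complete bipartite graph $K_{r-1,r-1}$ as a subgraph. Then $$\chi_{D_L}(G)\leq 2\Delta(G)-\Big(3\Big\lfloor\tfrac{\Delta(G)+1}{r}\Big\rfloor-2\Big).$$
   Context: A graph is $k$-connected if it has at least $k+1$ vertices and the removal of any $k-1$ or fewer vertices leaves a connected graph. A vertex coloring $f$ of a graph $G$ is distinguishing if the only automorphism $\phi$ of $G$ with $f(\phi(v))=f(v)$ for all vertices $v$ is the identity. A list assignment $L=\{L(v)\}_{v\in V(G)}$ assigns to each vertex a finite set of colors; $G$ is properly $L$-distinguishable if there is a proper vertex coloring $f$ of $G$ which is distinguishing and satisfies $f(v)\in L(v)$ for all $v$. The list-distinguishing chromatic number $\chi_{D_L}(G)$ is the minimum integer $k$ such that $G$ is properly $L$-distinguishable for every list assignment $L$ with $|L(v)|=k$ for all $v\in V(G)$. -}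

module Defs where

open import Data.Nat using (ℕ; zero; suc; _+_; _∸_; _≤_; _⊔_)
open import Data.Fin using (Fin)
open import Data.Bool using (Bool; true; false; T)
open import Data.List using (List; length; filterᵇ; allFin; map; foldr)
open import Data.List.Membership.Propositional using (_∈_)
open import Data.List.Relation.Unary.Unique.Propositional using (Unique)
open import Data.Product using (Σ; _×_; ∃)
open import Relation.Binary.PropositionalEquality using (_≡_; _≢_)
open import Relation.Nullary using (¬_)

record Graph (n : ℕ) : Set where
  field
    adj    : Fin n → Fin n → Bool
    sym    : ∀ u v → adj u v ≡ adj v u
    irrefl : ∀ v → adj v v ≡ false
open Graph public

Adj : ∀ {n} → Graph n → Fin n → Fin n → Set
Adj G u v = T (adj G u v)

degree : ∀ {n} → Graph n → Fin n → ℕ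
degree {n} G v = length (filterᵇ (adj G v) (allFin n))

maxDegree : ∀ {n} → Graph n → ℕ
maxDegree {n} G = foldr _⊔_ 0 (map (degree G) (allFin n))

data WalkAvoiding {n} (G : Graph n) (removed : Fin n → Set) : Fin n → Fin n → Set where
  here : ∀ {v} → ¬ removed v → WalkAvoiding G removed v v
  step : ∀ {u w v} → ¬ removed u → Adj G u w →
         WalkAvoiding G removed w v → WalkAvoiding G removed u v

ConnectedAfterRemoving : ∀ {n} → Graph n → (Fin n → Set) → Set
ConnectedAfterRemoving G removed =
  ∀ u v → ¬ removed u → ¬ removed v → WalkAvoiding G removed u v

Connected : ∀ {n} → Graph n → Set
Connected G = ConnectedAfterRemoving G (λ _ → Data.Empty.⊥)
  where import Data.Empty

KConnected : ∀ {n} → ℕ → Graph n → Set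
KConnected {n} k G =
  (k + 1 ≤ n) ×
  (∀ (S : List (Fin n)) → Unique S → length S ≤ k ∸ 1 →
     ConnectedAfterRemoving G (λ v → v ∈ S))

ContainsKmm : ∀ {n} → ℕ → Graph n → Set
ContainsKmm {n} m G =
  Σ (Fin m → Fin n) λ a → Σ (Fin m → Fin n) λ b →
    (∀ i j → a i ≡ a j → i ≡ j) ×
    (∀ i j → b i ≡ b j → i ≡ j) ×
    (∀ i j → a i ≢ b j) ×
    (∀ i j → Adj G (a i) (b j))

record Automorphism {n} (G : Graph n) : Set where
  field
    φ     : Fin n → Fin n
    φ⁻¹   : Fin n → Fin n
    left  : ∀ v → φ⁻¹ (φ v) ≡ v
    right : ∀ v → φ (φ⁻¹ v) ≡ v
    pres  : ∀ u v → adj G (φ u) (φ v) ≡ adj G u v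
open Automorphism public

Proper : ∀ {n} → Graph n → (Fin n → ℕ) → Set
Proper G f = ∀ u v → Adj G u v → f u ≢ f v

Distinguishing : ∀ {n} → Graph n → (Fin n → ℕ) → Set
Distinguishing G f =
  ∀ (σ : Automorphism G) → (∀ v → f (φ σ v) ≡ f v) → ∀ v → φ σ v ≡ v

ListAssignment : ∀ {n} → Graph n → ℕ → (Fin n → List ℕ) → Set
ListAssignment {n} G k L = ∀ v → Unique (L v) × length (L v) ≡ k

ProperlyLDistinguishable : ∀ {n} → Graph n → (Fin n → List ℕ) → Set
ProperlyLDistinguishable G L =
  Σ (_ → ℕ) λ f → Proper G f × Distinguishing G f × (∀ v → f v ∈ L v)

ListDistinguishableWith : ∀ {n} → Graph n → ℕ → Set
ListDistinguishableWith {n} G k =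
  ∀ (L : Fin n → List ℕ) → ListAssignment G k L → ProperlyLDistinguishable G L

-- χ_{D_L}(G) ≤ B  (the minimum k with the property is ≤ B iff some k ≤ B has it)
χDL≤ : ∀ {n} → Graph n → ℕ → Set
χDL≤ G B = Σ ℕ λ k → k ≤ B × ListDistinguishableWith G k

-- (n−r+1)-connectivity forces minimum degree at least n − r + 1, so n ≤ Δ + r − 1.
-- With q = ⌊(Δ+1)/r⌋ ≥ 2 and r ≥ 4 this gives n ≤ 2Δ − (3q − 2), and with q = 1 it
-- gives n ≤ 2Δ − 1 unless n = 2Δ; in those cases lists of n colours admit an
-- injective choice, which is proper and distinguishing. If n = 2Δ (hence r = Δ + 1)
-- the lists have n − 1 colours. Were every two non-adjacent vertices twins, r − 1
-- neighbours and r − 1 non-neighbours of a vertex would span a K_{r−1,r−1}; so some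
-- non-adjacent u, w are separated by a vertex x adjacent to exactly one of them.
-- Choose colours injectively except that u and w may share one. This is proper as
-- u ≁ w, and a colour-preserving automorphism fixes every vertex other than u and w,
-- in particular x, so it cannot exchange u and w.
{-# OPTIONS --safe #-}
module Submission where

open import Defs hiding (sym)
open import Data.Nat using (ℕ; suc; _+_; _*_; _∸_; _⊔_; _≤_; _<_; s≤s; NonZero)
open import Data.Nat.DivMod using (_/_; m/n*n≤m; m≥n⇒m/n>0)
open import Data.Nat.Properties
open import Data.Nat.Tactic.RingSolver using (solve)
open import Data.Fin using (Fin; inject≤; fromℕ<)
open import Data.Fin.Properties using (any?; all?; ¬∀⟶∃¬; inject≤-injective; injective⇒≤)
  renaming (_≟_ to _≟ᶠ_)
open import Data.Bool using (false; true; T)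
import Data.Bool.Properties as Bool
open import Data.List using (List; []; _∷_; length; map; filter; filterᵇ; allFin; lookup; foldr)
open import Data.List.Properties using (length-map; length-tabulate; filter-notAll)
open import Data.List.Relation.Unary.Any using (here; there)
import Data.List.Relation.Unary.Any as Any
import Data.List.Relation.Unary.All as All
open import Data.List.Relation.Unary.AllPairs using (_∷_)
open import Data.List.Relation.Unary.Unique.Propositional using (Unique)
open import Data.List.Relation.Unary.Unique.Propositional.Properties
  using (allFin⁺; filter⁺; Unique[x∷xs]⇒x∉xs)
open import Data.List.Relation.Binary.Subset.Propositional using (_⊆_)
open import Data.List.Membership.Propositional using (_∈_; _∉_; find; lose)
open import Data.List.Membership.Propositional.Properties
  using (∈-map⁺; ∈-filter⁺; ∈-filter⁻; ∈-lookup; ∈-allFin)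
import Data.List.Membership.Setoid.Properties as SetoidMembership
import Data.List.Membership.DecPropositional as DecMembership
open import Data.Vec.Functional using (updateAt)
open import Data.Vec.Functional.Properties using (updateAt-updates; updateAt-minimal)
open import Data.Product using (∃; ∃₂; _×_; _,_; proj₁; proj₂)
open import Data.Sum using (_⊎_; inj₁; inj₂; [_,_]′)
open import Data.Empty using (⊥-elim)
open import Function using (_∘_; id; const)
open import Function.Definitions using (Injective)
open import Relation.Nullary using (¬_; Dec; yes; no; does; contradiction; ¬?)
open import Relation.Nullary.Decidable using (T?; _×-dec_; decidable-stable)
open import Relation.Unary using (Pred; Decidable)
open import Relation.Unary.Properties using (∁?)
open import Relation.Binary.Definitions using (DecidableEquality)
open import Relation.Binary.PropositionalEquality

module _ {A : Set} where

  lookup-injective : ∀ {xs : List A} → Unique xs → ∀ i j → lookup xs i ≡ lookup xs j → i ≡ j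
  lookup-injective (_ ∷ _)      Fin.zero    Fin.zero    _  = refl
  lookup-injective (x≢xs ∷ _)   Fin.zero    (Fin.suc j) eq = ⊥-elim (All.lookup x≢xs (∈-lookup j) eq)
  lookup-injective (x≢xs ∷ _)   (Fin.suc i) Fin.zero    eq = ⊥-elim (All.lookup x≢xs (∈-lookup i) (sym eq))
  lookup-injective (_ ∷ xs!)    (Fin.suc i) (Fin.suc j) eq = cong Fin.suc (lookup-injective xs! i j eq)

  Unique∧⊆⇒length≤ : ∀ {xs ys : List A} → Unique xs → xs ⊆ ys → length xs ≤ length ys
  Unique∧⊆⇒length≤ xs! xs⊆ys = injective⇒≤ λ {i} {j} eq →
    lookup-injective xs! i j
      (SetoidMembership.index-injective (setoid A) (xs⊆ys (∈-lookup i)) (xs⊆ys (∈-lookup j)) eq)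

  length-filter+length-filter-∁ : ∀ {p} {P : Pred A p} (P? : Decidable P) xs →
    length (filter P? xs) + length (filter (∁? P?) xs) ≡ length xs
  length-filter+length-filter-∁ P? [] = refl
  length-filter+length-filter-∁ P? (x ∷ xs) with ih ← length-filter+length-filter-∁ P? xs | does (P? x)
  ... | true  = cong suc ih
  ... | false = trans (+-suc _ _) (cong suc ih)

  InjectiveOn : ∀ {B : Set} → (A → B) → List A → Set
  InjectiveOn f xs = ∀ {x y} → x ∈ xs → y ∈ xs → f x ≡ f y → x ≡ y

module _ {A : Set} (_≟_ : DecidableEquality A) where
  open DecMembership _≟_ using (_∈?_)

  length<⇒∃∉ : ∀ {xs ys : List A} → Unique ys → length xs < length ys → ∃ λ y → y ∈ ys × y ∉ xs
  length<⇒∃∉ {xs} {ys} ys! xs<ys with Any.any? (λ y → ¬? (y ∈? xs)) ys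
  ... | yes some = find some
  ... | no none  = contradiction (Unique∧⊆⇒length≤ ys! ys⊆xs) (<⇒≱ xs<ys)
    where
    ys⊆xs : ys ⊆ xs
    ys⊆xs {y} y∈ys = decidable-stable (y ∈? xs) (none ∘ lose y∈ys)

  without : A → List A → List A
  without v = filter (λ y → ¬? (y ≟ v))

  Unique-without : ∀ {v xs} → Unique xs → Unique (without v xs)
  Unique-without = filter⁺ _

  ∈-without : ∀ {v y xs} → y ∈ xs → y ≢ v → y ∈ without v xs
  ∈-without = ∈-filter⁺ _

  ∈-without⁻ : ∀ {v y} xs → y ∈ without v xs → y ≢ v
  ∈-without⁻ {v} xs = proj₂ ∘ ∈-filter⁻ (λ y → ¬? (y ≟ v)) {xs = xs}

  ∉-without : ∀ {v} xs → v ∉ without v xs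
  ∉-without xs v∈ = ∈-without⁻ xs v∈ refl

  ∈-∷-without : ∀ {v w xs} → v ∈ xs → v ∈ w ∷ without w xs
  ∈-∷-without {v} {w} v∈xs with v ≟ w
  ... | yes refl = here refl
  ... | no  v≢w  = there (∈-without v∈xs v≢w)

  length-without< : ∀ {v xs} → v ∈ xs → length (without v xs) < length xs
  length-without< {xs = xs} v∈xs = filter-notAll _ xs (lose v∈xs λ v≢v → v≢v refl)

m<n⇒m≤n∸1 : ∀ {m n} → m < n → m ≤ n ∸ 1
m<n⇒m≤n∸1 {n = suc _} (s≤s m≤n) = m≤n

ChoiceOn : ∀ {A : Set} → (A → List ℕ) → (A → ℕ) → List A → Set
ChoiceOn L f xs = ∀ {x} → x ∈ xs → f x ∈ L x

module _ {n} {f : Fin n → ℕ} {x : Fin n} {c : ℕ} {xs : List (Fin n)} (x∉xs : x ∉ xs) where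

  updateAt-agreesOn : ∀ {y} → y ∈ xs → updateAt f x (const c) y ≡ f y
  updateAt-agreesOn y∈xs = updateAt-minimal _ x f λ { refl → x∉xs y∈xs }

  updateAt-choiceOn : ∀ {L} → ChoiceOn L f xs → c ∈ L x → ChoiceOn L (updateAt f x (const c)) (x ∷ xs)
  updateAt-choiceOn {L} f∈L c∈Lx (here refl)    = subst (_∈ L x) (sym (updateAt-updates x f)) c∈Lx
  updateAt-choiceOn {L} f∈L c∈Lx {y} (there y∈) = subst (_∈ L y) (sym (updateAt-agreesOn y∈)) (f∈L y∈)

  updateAt-injectiveOn : InjectiveOn f xs → c ∉ map f xs → InjectiveOn (updateAt f x (const c)) (x ∷ xs)
  updateAt-injectiveOn f-inj c∉f[xs] = injective
    where
    fx≢fy : ∀ {y} → y ∈ xs → updateAt f x (const c) x ≢ updateAt f x (const c) y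
    fx≢fy {y} y∈xs eq = c∉f[xs] (subst (_∈ map f xs) fy≡c (∈-map⁺ f y∈xs))
      where
      open ≡-Reasoning
      fy≡c : f y ≡ c
      fy≡c = begin
        f y                      ≡⟨ updateAt-agreesOn y∈xs ⟨
        updateAt f x (const c) y ≡⟨ eq ⟨
        updateAt f x (const c) x ≡⟨ updateAt-updates x f ⟩
        c                        ∎
    injective : InjectiveOn (updateAt f x (const c)) (x ∷ xs)
    injective (here refl) (here refl) _  = refl
    injective (here refl) (there y∈)  eq = ⊥-elim (fx≢fy y∈ eq)
    injective (there y∈)  (here refl) eq = ⊥-elim (fx≢fy y∈ (sym eq))
    injective (there y∈)  (there z∈)  eq =
      f-inj y∈ z∈ (trans (sym (updateAt-agreesOn y∈)) (trans eq (updateAt-agreesOn z∈)))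

InjectiveExcept : ∀ {n} → (Fin n → ℕ) → Fin n → Fin n → Set
InjectiveExcept f u w = ∀ {a b} → f a ≡ f b → a ≡ b ⊎ (a ≡ u × b ≡ w) ⊎ (a ≡ w × b ≡ u)

allBut : ∀ {n} → Fin n → List (Fin n)
allBut {n} v = without _≟ᶠ_ v (allFin n)

∈-allBut : ∀ {n} {v y : Fin n} → y ≢ v → y ∈ allBut v
∈-allBut = ∈-without _≟ᶠ_ (∈-allFin _)

length-allBut : ∀ {n} (v : Fin n) → length (allBut v) ≤ n ∸ 1
length-allBut {n} v =
  m<n⇒m≤n∸1 (subst (length (allBut v) <_) (length-tabulate {n = n} id) (length-without< _≟ᶠ_ (∈-allFin v)))

module _ {n} {u w : Fin n} (u≢w : u ≢ w) {f : Fin n → ℕ} {c : ℕ} where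

  updateAt-injectiveExcept : InjectiveOn f (allBut w) → c ∉ map f (without _≟ᶠ_ w (allBut u)) →
    InjectiveExcept (updateAt f w (const c)) u w
  updateAt-injectiveExcept f-inj c∉f[zs] {a} {b} eq = cases (a ≟ᶠ w) (b ≟ᶠ w) (a ≟ᶠ u) (b ≟ᶠ u)
    where
    F : Fin n → ℕ
    F = updateAt f w (const c)
    zs : List (Fin n)
    zs = without _≟ᶠ_ w (allBut u)
    F-inj-allBut : InjectiveOn F (allBut w)
    F-inj-allBut a∈ b∈ Fa≡Fb = f-inj a∈ b∈ (begin
      f _ ≡⟨ updateAt-agreesOn (∉-without _≟ᶠ_ (allFin n)) a∈ ⟨
      F _ ≡⟨ Fa≡Fb ⟩
      F _ ≡⟨ updateAt-agreesOn (∉-without _≟ᶠ_ (allFin n)) b∈ ⟩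
      f _ ∎)
      where open ≡-Reasoning
    zs⊆allBut : zs ⊆ allBut w
    zs⊆allBut y∈ = ∈-allBut (∈-without⁻ _≟ᶠ_ (allBut u) y∈)
    F-inj-w∷zs : InjectiveOn F (w ∷ zs)
    F-inj-w∷zs = updateAt-injectiveOn (∉-without _≟ᶠ_ (allBut u))
                   (λ a∈ b∈ → f-inj (zs⊆allBut a∈) (zs⊆allBut b∈)) c∉f[zs]
    ∈w∷zs : ∀ {v} → v ≢ u → v ∈ w ∷ zs
    ∈w∷zs = ∈-∷-without _≟ᶠ_ ∘ ∈-allBut
    cases : Dec (a ≡ w) → Dec (b ≡ w) → Dec (a ≡ u) → Dec (b ≡ u) →
            a ≡ b ⊎ (a ≡ u × b ≡ w) ⊎ (a ≡ w × b ≡ u)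
    cases (no a≢w) (no b≢w) _ _         = inj₁ (F-inj-allBut (∈-allBut a≢w) (∈-allBut b≢w) eq)
    cases _ _ (no a≢u) (no b≢u)         = inj₁ (F-inj-w∷zs (∈w∷zs a≢u) (∈w∷zs b≢u) eq)
    cases (yes a≡w) _ _ (yes b≡u)       = inj₂ (inj₂ (a≡w , b≡u))
    cases _ (yes b≡w) (yes a≡u) _       = inj₂ (inj₁ (a≡u , b≡w))
    cases (yes a≡w) _ (yes a≡u) _       = ⊥-elim (u≢w (trans (sym a≡u) a≡w))
    cases _ (yes b≡w) _ (yes b≡u)       = ⊥-elim (u≢w (trans (sym b≡u) b≡w))

module _ {n} (L : Fin n → List ℕ) (L! : ∀ v → Unique (L v)) where

  greedy : ∀ xs → Unique xs → (∀ {x} → x ∈ xs → length xs ≤ length (L x)) →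
           ∃ λ f → ChoiceOn L f xs × InjectiveOn f xs
  greedy []       _           _    = const 0 , (λ ()) , (λ ())
  greedy (x ∷ xs) x∷xs!@(_ ∷ xs!) long
    with f , f∈L , f-inj ← greedy xs xs! (λ y∈xs → ≤-trans (n≤1+n _) (long (there y∈xs)))
    with c , c∈Lx , c∉f[xs] ← length<⇒∃∉ _≟_ (L! x)
                                 (≤-trans (s≤s (≤-reflexive (length-map f xs))) (long (here refl)))
    = updateAt f x (const c) , updateAt-choiceOn x∉xs f∈L c∈Lx , updateAt-injectiveOn x∉xs f-inj c∉f[xs]
    where
    x∉xs : x ∉ xs
    x∉xs = Unique[x∷xs]⇒x∉xs x∷xs!

  injective-choice : (∀ v → n ≤ length (L v)) → ∃ λ f → (∀ v → f v ∈ L v) × Injective _≡_ _≡_ f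
  injective-choice long =
    let f , f∈L , f-inj = greedy (allFin n) (allFin⁺ n)
                                 (λ {v} _ → ≤-trans (≤-reflexive (length-tabulate _)) (long v))
    in f , f∈L ∘ ∈-allFin , f-inj (∈-allFin _) (∈-allFin _)

  injectiveExcept-choice : (∀ v → n ∸ 1 ≤ length (L v)) → ∀ {u w} → u ≢ w →
    ∃ λ F → (∀ v → F v ∈ L v) × InjectiveExcept F u w
  injectiveExcept-choice long {u} {w} u≢w =
    let f , f∈L , f-inj = greedy (allBut w) (Unique-without _≟ᶠ_ (allFin⁺ n))
                                 (λ {v} _ → ≤-trans (length-allBut w) (long v))
        zs = without _≟ᶠ_ w (allBut u)
        |zs|<|Lw| = ≤-trans (length-without< _≟ᶠ_ (∈-allBut (u≢w ∘ sym)))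
                            (≤-trans (length-allBut u) (long w))
        c , c∈Lw , c∉f[zs] = length<⇒∃∉ _≟_ {xs = map f zs} (L! w)
                                         (≤-trans (s≤s (≤-reflexive (length-map f zs))) |zs|<|Lw|)
    in updateAt f w (const c) ,
       updateAt-choiceOn (∉-without _≟ᶠ_ (allFin n)) f∈L c∈Lw ∘ ∈-∷-without _≟ᶠ_ ∘ ∈-allFin ,
       updateAt-injectiveExcept u≢w f-inj c∉f[zs]

¬T⇒≡false : ∀ {b} → ¬ T b → b ≡ false
¬T⇒≡false {false} _  = refl
¬T⇒≡false {true}  ¬t = contradiction _ ¬t

∈⇒≤foldr-⊔ : ∀ {x xs} → x ∈ xs → x ≤ foldr _⊔_ 0 xs
∈⇒≤foldr-⊔ {xs = y ∷ ys} (here refl) = m≤m⊔n y _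
∈⇒≤foldr-⊔ {xs = y ∷ ys} (there x∈) = ≤-trans (∈⇒≤foldr-⊔ x∈) (m≤n⊔m y _)

module _ {n} (G : Graph n) where

  ¬Adj-refl : ∀ v → ¬ Adj G v v
  ¬Adj-refl v = subst T (irrefl G v)

  ¬Adj-sym : ∀ {u w} → ¬ Adj G u w → ¬ Adj G w u
  ¬Adj-sym u≁w w~u = u≁w (subst T (Graph.sym G _ _) w~u)

  degree≤maxDegree : ∀ v → degree G v ≤ maxDegree G
  degree≤maxDegree v = ∈⇒≤foldr-⊔ (∈-map⁺ (degree G) (∈-allFin v))

  neighbours : Fin n → List (Fin n)
  neighbours v = filterᵇ (adj G v) (allFin n)

  nonNeighbours : Fin n → List (Fin n)
  nonNeighbours v = filter (∁? (T? ∘ adj G v)) (allFin n)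

  ∈-neighbours⁺ : ∀ {v y} → Adj G v y → y ∈ neighbours v
  ∈-neighbours⁺ = ∈-filter⁺ (T? ∘ adj G _) (∈-allFin _)

  ∈-neighbours⁻ : ∀ {v y} → y ∈ neighbours v → Adj G v y
  ∈-neighbours⁻ {v} = proj₂ ∘ ∈-filter⁻ (T? ∘ adj G v) {xs = allFin n}

  ∈-nonNeighbours⁻ : ∀ {v y} → y ∈ nonNeighbours v → ¬ Adj G v y
  ∈-nonNeighbours⁻ {v} = proj₂ ∘ ∈-filter⁻ (∁? (T? ∘ adj G v)) {xs = allFin n}

  degree+length-nonNeighbours : ∀ v → degree G v + length (nonNeighbours v) ≡ n
  degree+length-nonNeighbours v =
    trans (length-filter+length-filter-∁ (T? ∘ adj G v) (allFin n)) (length-tabulate _)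

  walk-source-kept : ∀ {R u v} → WalkAvoiding G R u v → ¬ R u
  walk-source-kept (here u∉R)     = u∉R
  walk-source-kept (step u∉R _ _) = u∉R

  -- Deleting the fewer than k neighbours of v separates v from the vertices outside
  -- v ∷ neighbours v, of which there is one since n ≥ k + 1.
  KConnected⇒k≤degree : ∀ {k} → KConnected k G → ∀ v → k ≤ degree G v
  KConnected⇒k≤degree {k} (k+1≤n , connected) v with k ≤? degree G v
  ... | yes k≤d = k≤d
  ... | no  k≰d =
    let w , _ , w∉v∷N = length<⇒∃∉ _≟ᶠ_ (allFin⁺ n) v∷N<n in
    ⊥-elim (no-walk (w∉v∷N ∘ here ∘ sym)
                    (connected N (filter⁺ _ (allFin⁺ n)) d≤k∸1 v w v∉N (w∉v∷N ∘ there)))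
    where
    N : List (Fin n)
    N = neighbours v
    d<k : degree G v < k
    d<k = ≰⇒> k≰d
    d≤k∸1 : length N ≤ k ∸ 1
    d≤k∸1 = m<n⇒m≤n∸1 d<k
    v∷N<n : length (v ∷ N) < length (allFin n)
    v∷N<n = subst (suc (length (v ∷ N)) ≤_) (sym (length-tabulate _))
                  (≤-trans (s≤s d<k) (subst (_≤ n) (+-comm k 1) k+1≤n))
    v∉N : v ∉ N
    v∉N = ¬Adj-refl v ∘ ∈-neighbours⁻
    no-walk : ∀ {w} → v ≢ w → ¬ WalkAvoiding G (_∈ N) v w
    no-walk v≢w (here _)          = v≢w refl
    no-walk _   (step _ v~y walk) = walk-source-kept walk (∈-neighbours⁺ v~y)

  Twins : Fin n → Fin n → Set
  Twins u w = ∀ x → adj G u x ≡ adj G w x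

  Separates : Fin n → Fin n → Fin n → Set
  Separates x u w = adj G u x ≢ adj G w x

  twins? : ∀ u w → Dec (Twins u w)
  twins? u w = all? λ x → adj G u x Bool.≟ adj G w x

  -- Any m non-neighbours of v (v included) are twins of v, hence adjacent to all its neighbours.
  nonadjacent-twins⇒Kmm : (∀ u w → ¬ Adj G u w → Twins u w) →
    ∀ {m} v → m ≤ degree G v → degree G v + m ≤ n → ContainsKmm m G
  nonadjacent-twins⇒Kmm twins {m} v m≤d d+m≤n = a , b , a-inj , b-inj , a≢b , a~b
    where
    m≤|A| : m ≤ length (nonNeighbours v)
    m≤|A| = +-cancelˡ-≤ (degree G v) _ _
              (subst (degree G v + m ≤_) (sym (degree+length-nonNeighbours v)) d+m≤n)
    a b : Fin m → Fin n
    a i = lookup (nonNeighbours v) (inject≤ i m≤|A|)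
    b j = lookup (neighbours v) (inject≤ j m≤d)
    a-inj : ∀ i j → a i ≡ a j → i ≡ j
    a-inj i j = inject≤-injective _ _ i j ∘ lookup-injective (filter⁺ _ (allFin⁺ n)) _ _
    b-inj : ∀ i j → b i ≡ b j → i ≡ j
    b-inj i j = inject≤-injective _ _ i j ∘ lookup-injective (filter⁺ _ (allFin⁺ n)) _ _
    v≁a : ∀ i → ¬ Adj G v (a i)
    v≁a i = ∈-nonNeighbours⁻ (∈-lookup _)
    v~b : ∀ j → Adj G v (b j)
    v~b j = ∈-neighbours⁻ (∈-lookup _)
    a≢b : ∀ i j → a i ≢ b j
    a≢b i j ai≡bj = v≁a i (subst (Adj G v) (sym ai≡bj) (v~b j))
    a~b : ∀ i j → Adj G (a i) (b j)
    a~b i j = subst T (twins v (a i) (v≁a i) (b j)) (v~b j)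

  nonadjacent-separated-pair : ∀ {m} → ¬ ContainsKmm m G →
    ∀ v → m ≤ degree G v → degree G v + m ≤ n →
    ∃₂ λ u w → ¬ Adj G u w × ∃ λ x → Separates x u w
  nonadjacent-separated-pair ¬Kmm v m≤d d+m≤n
    with any? (λ u → any? (λ w → ¬? (T? (adj G u w)) ×-dec ¬? (twins? u w)))
  ... | yes (u , w , u≁w , ¬twins) =
    u , w , u≁w , ¬∀⟶∃¬ n _ (λ x → adj G u x Bool.≟ adj G w x) ¬twins
  ... | no ∄ = contradiction (nonadjacent-twins⇒Kmm twins v m≤d d+m≤n) ¬Kmm
    where
    twins : ∀ u w → ¬ Adj G u w → Twins u w
    twins u w u≁w = decidable-stable (twins? u w) λ ¬twins → ∄ (u , w , u≁w , ¬twins)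

  injective⇒proper : ∀ {f} → Injective _≡_ _≡_ f → Proper G f
  injective⇒proper f-inj a b a~b fa≡fb with f-inj fa≡fb
  ... | refl = ¬Adj-refl a a~b

  injective⇒distinguishing : ∀ {f} → Injective _≡_ _≡_ f → Distinguishing G f
  injective⇒distinguishing f-inj σ f∘σ≗f v = f-inj (f∘σ≗f v)

  adj-invariant-if-fixed : ∀ (σ : Automorphism G) {x a b} →
    φ σ x ≡ x → φ σ a ≡ b → adj G a x ≡ adj G b x
  adj-invariant-if-fixed σ {x} {a} σx≡x refl = trans (sym (pres σ a x)) (cong (adj G (φ σ a)) σx≡x)

module _ {n} (G : Graph n) {f : Fin n → ℕ} {u w} (u≁w : ¬ Adj G u w) (f-inj : InjectiveExcept f u w) where

  injectiveExcept⇒proper : Proper G f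
  injectiveExcept⇒proper a b a~b fa≡fb with f-inj fa≡fb
  ... | inj₁ refl                 = ¬Adj-refl G a a~b
  ... | inj₂ (inj₁ (refl , refl)) = u≁w a~b
  ... | inj₂ (inj₂ (refl , refl)) = ¬Adj-sym G u≁w a~b

  -- x ≠ u, w as u ≁ w, so x keeps its colour class and is fixed.
  fixes-separator : ∀ {x} → Separates G x u w →
    ∀ (σ : Automorphism G) → (∀ v → f (φ σ v) ≡ f v) → φ σ x ≡ x
  fixes-separator {x} separated σ f∘σ≗f with f-inj (f∘σ≗f x)
  ... | inj₁ σx≡x             = σx≡x
  ... | inj₂ (inj₁ (_ , refl)) = ⊥-elim (separated (trans (¬T⇒≡false u≁w) (sym (irrefl G w))))
  ... | inj₂ (inj₂ (_ , refl)) =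
    ⊥-elim (separated (trans (irrefl G u) (sym (¬T⇒≡false (¬Adj-sym G u≁w)))))

  injectiveExcept⇒distinguishing : ∀ x → Separates G x u w → Distinguishing G f
  injectiveExcept⇒distinguishing x separated σ f∘σ≗f v with f-inj (f∘σ≗f v)
  ... | inj₁ σv≡v                 = σv≡v
  ... | inj₂ (inj₁ (σw≡u , refl)) =
    ⊥-elim (separated (sym (adj-invariant-if-fixed G σ (fixes-separator separated σ f∘σ≗f) σw≡u)))
  ... | inj₂ (inj₂ (σu≡w , refl)) =
    ⊥-elim (separated (adj-invariant-if-fixed G σ (fixes-separator separated σ f∘σ≗f) σu≡w))

module _ {n} (G : Graph n) where

  listDistinguishable-order : ListDistinguishableWith G n
  listDistinguishable-order L L-assign =
    let f , f∈L , f-inj = injective-choice L (proj₁ ∘ L-assign) (≤-reflexive ∘ sym ∘ proj₂ ∘ L-assign)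
    in f , injective⇒proper G f-inj , injective⇒distinguishing G f-inj , f∈L

  listDistinguishable-order∸1 : ∀ {u w} → ¬ Adj G u w → ∀ x → Separates G x u w →
    ListDistinguishableWith G (n ∸ 1)
  listDistinguishable-order∸1 u≁w x separated L L-assign =
    let F , F∈L , F-inj = injectiveExcept-choice L (proj₁ ∘ L-assign)
                                                 (≤-reflexive ∘ sym ∘ proj₂ ∘ L-assign)
                                                 (λ { refl → separated refl })
    in F , injectiveExcept⇒proper G u≁w F-inj , injectiveExcept⇒distinguishing G u≁w F-inj x separated , F∈L

m∸n+1≤o⇒m+1≤n+o : ∀ {m n o} → m ∸ n + 1 ≤ o → m + 1 ≤ n + o
m∸n+1≤o⇒m+1≤n+o {m} {n} {o} h = begin
  m + 1             ≤⟨ +-monoˡ-≤ 1 (m≤n+m∸n m n) ⟩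
  n + (m ∸ n) + 1   ≡⟨ +-assoc n (m ∸ n) 1 ⟩
  n + (m ∸ n + 1)   ≤⟨ +-monoʳ-≤ n h ⟩
  n + o             ∎
  where open ≤-Reasoning

order≤bound⊎order≡2Δ : ∀ {n r Δ} q → 4 ≤ r → 1 ≤ q → q * r ≤ Δ + 1 → n + 1 ≤ r + Δ →
  n ≤ 2 * Δ ∸ (3 * q ∸ 2) ⊎ (n ≡ 2 * Δ × n ∸ 1 ≤ 2 * Δ ∸ (3 * q ∸ 2))
order≤bound⊎order≡2Δ {n} {r} {Δ} 1 _ _ r≤Δ+1 n+1≤r+Δ with m≤n⇒m<n∨m≡n n≤2Δ
  where
  n≤2Δ : n ≤ 2 * Δ
  n≤2Δ = +-cancelʳ-≤ 1 n (2 * Δ) (begin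
    n + 1        ≤⟨ n+1≤r+Δ ⟩
    r + Δ        ≤⟨ +-monoˡ-≤ Δ (subst (_≤ Δ + 1) (*-identityˡ r) r≤Δ+1) ⟩
    (Δ + 1) + Δ  ≡⟨ solve (Δ ∷ []) ⟩
    2 * Δ + 1    ∎)
    where open ≤-Reasoning
... | inj₁ n<2Δ = inj₁ (m<n⇒m≤n∸1 n<2Δ)
... | inj₂ n≡2Δ = inj₂ (n≡2Δ , ∸-monoˡ-≤ 1 (≤-reflexive n≡2Δ))
order≤bound⊎order≡2Δ {n} {r} {Δ} (suc (suc p)) 4≤r _ qr≤Δ+1 n+1≤r+Δ =
  inj₁ (m+n≤o⇒m≤o∸n n (+-cancelʳ-≤ 1 _ _ (begin
    n + (3 * (2 + p) ∸ 2) + 1  ≡⟨ cong (λ k → n + (k ∸ 2) + 1) 3[2+p]≡2+[4+3p] ⟩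
    n + (4 + 3 * p) + 1        ≡⟨ solve (n ∷ p ∷ []) ⟩
    (n + 1) + (4 + p * 3)      ≤⟨ +-mono-≤ n+1≤r+Δ (+-mono-≤ 4≤r (*-monoʳ-≤ p 3≤r)) ⟩
    (r + Δ) + (r + p * r)      ≡⟨ solve (r ∷ Δ ∷ p ∷ []) ⟩
    Δ + (2 + p) * r            ≤⟨ +-monoʳ-≤ Δ qr≤Δ+1 ⟩
    Δ + (Δ + 1)                ≡⟨ solve (Δ ∷ []) ⟩
    2 * Δ + 1                  ∎)))
  where
  open ≤-Reasoning
  3≤r : 3 ≤ r
  3≤r = ≤-trans (n≤1+n 3) 4≤r
  3[2+p]≡2+[4+3p] : 3 * (2 + p) ≡ 2 + (4 + 3 * p)
  3[2+p]≡2+[4+3p] = solve (p ∷ [])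

order≡2Δ⇒Kmm-size : ∀ {n r d Δ} → n ≡ 2 * Δ → r ≤ Δ + 1 → n + 1 ≤ r + d → d ≤ Δ →
  r ∸ 1 ≤ d × d + (r ∸ 1) ≤ n
order≡2Δ⇒Kmm-size {n} {r} {d} {Δ} n≡2Δ r≤Δ+1 n+1≤r+d d≤Δ =
  ≤-trans r∸1≤Δ Δ≤d , (begin
    d + (r ∸ 1)  ≤⟨ +-mono-≤ d≤Δ r∸1≤Δ ⟩
    Δ + Δ        ≡⟨ solve (Δ ∷ []) ⟩
    2 * Δ        ≡⟨ n≡2Δ ⟨
    n            ∎)
  where
  open ≤-Reasoning
  r∸1≤Δ : r ∸ 1 ≤ Δ
  r∸1≤Δ = subst (r ∸ 1 ≤_) (m+n∸n≡m Δ 1) (∸-monoˡ-≤ 1 r≤Δ+1)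
  Δ≤d : Δ ≤ d
  Δ≤d = ≤-pred (+-cancelˡ-≤ Δ _ _ (begin
    Δ + (1 + Δ)  ≡⟨ solve (Δ ∷ []) ⟩
    2 * Δ + 1    ≡⟨ cong (_+ 1) n≡2Δ ⟨
    n + 1        ≤⟨ n+1≤r+d ⟩
    r + d        ≤⟨ +-monoˡ-≤ d r≤Δ+1 ⟩
    (Δ + 1) + d  ≡⟨ solve (Δ ∷ d ∷ []) ⟩
    Δ + (1 + d)  ∎))

theorem4p3 : ∀ {n} (G : Graph n) (r : ℕ) .{{_ : NonZero r}} →
    Connected G →
    7 ≤ r → r ≤ maxDegree G + 1 →
    KConnected (n ∸ r + 1) G →
    ¬ ContainsKmm (r ∸ 1) G →
    χDL≤ G (2 * maxDegree G ∸ (3 * ((maxDegree G + 1) / r) ∸ 2))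
theorem4p3 {n} G r _ 7≤r r≤Δ+1 kconn ¬Kmm =
  [ (λ n≤B → n , n≤B , listDistinguishable-order G)
  , (λ (n≡2Δ , n∸1≤B) → n ∸ 1 , n∸1≤B , order≡2Δ⇒distinguishable n≡2Δ)
  ]′ (order≤bound⊎order≡2Δ ((Δ + 1) / r) (≤-trans (m≤m+n 4 3) 7≤r)
        (m≥n⇒m/n>0 r≤Δ+1) (m/n*n≤m (Δ + 1) r) (≤-trans n+1≤r+d (+-monoʳ-≤ r d≤Δ)))
  where
  Δ : ℕ
  Δ = maxDegree G
  v : Fin n
  v = fromℕ< (≤-trans (m≤n+m 1 (n ∸ r + 1)) (proj₁ kconn))
  d≤Δ : degree G v ≤ Δ
  d≤Δ = degree≤maxDegree G v
  n+1≤r+d : n + 1 ≤ r + degree G v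
  n+1≤r+d = m∸n+1≤o⇒m+1≤n+o (KConnected⇒k≤degree G kconn v)
  order≡2Δ⇒distinguishable : n ≡ 2 * Δ → ListDistinguishableWith G (n ∸ 1)
  order≡2Δ⇒distinguishable n≡2Δ =
    let r∸1≤d , d+r∸1≤n = order≡2Δ⇒Kmm-size n≡2Δ r≤Δ+1 n+1≤r+d d≤Δ
        u , w , u≁w , x , separated = nonadjacent-separated-pair G ¬Kmm v r∸1≤d d+r∸1≤n
    in listDistinguishable-order∸1 G u≁w x separated
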